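{- If the weak $3x+1$ conjecture holds, then the wild numbers conjecture is true; that is, the wild integer semigroup $\mathcal{W}(\mathbb{Z})$ consists exactly of all positive integers not divisible by $3$, equivalently the wild numbers are exactly the prime numbers other than $3$.
   Context: For integers $n\ge 0$ let $g(n)=\frac{3n+2}{2n+1}$. The wild semigroup $\mathcal{W}$ is the multiplicative semigroup of positive rationals generated by $\{g(n): n\ge 0\}$ together with $\frac12$ (all finite products, repetitions allowed). The wild integer semigroup is $\mathcal{W}(\mathbb{Z})=\mathcal{W}\cap\mathbb{Z}$; the wild numbers are its irreducible elements (elements not expressible as a product of two nonunits of $\mathcal{W}(\mathbb{Z})$). The weak $3x+1$ conjecture is the assertion that the semigroup $\mathcal{W}^{ -1}=\{w^{ -1}: w\in\mathcal{W}\}$ (generated by $\{\frac{2n+1}{3n+2}: n\ge 0\}$ together with $2$) contains every positive integer. -}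

module Defs where

open import Data.Nat using (ℕ; zero; suc; _+_; _*_)
open import Data.Integer using (+_)
open import Data.Rational using (ℚ; _/_) renaming (_*_ to _*ℚ_)
open import Data.Product using (_×_; ∃-syntax)
open import Relation.Binary.PropositionalEquality using (_≡_; _≢_)
open import Relation.Nullary using (¬_)

⟦_⟧ : ℕ → ℚ
⟦ n ⟧ = + n / 1

g : ℕ → ℚ
g n = + (3 * n + 2) / suc (2 * n)

ginv : ℕ → ℚ
ginv n = + (suc (2 * n)) / suc (3 * n + 1)

data InW : ℚ → Set where
  gen  : (n : ℕ) → InW (g n)
  half : InW (+ 1 / 2)
  mul  : {x y : ℚ} → InW x → InW y → InW (x *ℚ y)

data InWinv : ℚ → Set where
  gen  : (n : ℕ) → InWinv (ginv n)
  two  : InWinv (+ 2 / 1)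
  mul  : {x y : ℚ} → InWinv x → InWinv y → InWinv (x *ℚ y)

-- The wild integer semigroup 𝒲(ℤ) = 𝒲 ∩ ℤ (its elements are positive, so indexed by ℕ).
InWZ : ℕ → Set
InWZ n = InW ⟦ n ⟧

Weak3x+1 : Set
Weak3x+1 = (n : ℕ) → InWinv ⟦ suc n ⟧

-- Wild numbers: irreducible elements of 𝒲(ℤ) (nonunit, i.e. ≠ 1, and not a
-- product of two nonunits of 𝒲(ℤ)).
Wild : ℕ → Set
Wild n = InWZ n × n ≢ 1 ×
  ¬ (∃[ a ] ∃[ b ] (InWZ a × InWZ b × a ≢ 1 × b ≢ 1 × n ≡ a * b))

-- The generators 1/2 and g(k) = (3k+2)/(2k+1) have numerators prime to 3, hence so does every
-- element of 𝒲, and 3 divides no element of 𝒲(ℤ). Conversely, the weak 3x+1 conjecture puts 1/m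
-- into 𝒲 for every m ≥ 1, which makes 𝒲(ℤ) closed under divisors; since g(k)·(2k+1) = 3k+2,
-- 𝒲(ℤ) also contains 3m+1 together with every odd m. By strong induction only the primes p ≥ 5
-- remain; 5 is an explicit product of generators and 7, …, 19 divide some 3m+1 with m already
-- known. In general, if N and Y are odd elements of 𝒲(ℤ) with p ∤ Y and p ∣ 3N+Y, choose k with
-- Yᵏ⁺¹ ≡ 1 (mod p): then d = N·Yᵏ is an odd element of 𝒲(ℤ) with p ∣ 3d+1, so p ∈ 𝒲(ℤ). For
-- p > 20 with p ≡ ±1 (mod 6), suitable N and Y are products of smaller numbers prime to 3.
-- Finally, the irreducibles of the monoid of positive integers prime to 3 are the primes ≠ 3.

module Submission where

open import Defs
open import Data.Nat using (ℕ)
open import Data.Nat.Divisibility using (_∣_)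
open import Data.Nat.Primality using (Prime)
open import Data.Product using (_×_)
open import Function.Bundles using (_⇔_)
open import Relation.Binary.PropositionalEquality using (_≢_)
open import Relation.Nullary using (¬_)

open import Algebra.Bundles using (CommutativeMonoid)
open import Data.Empty using (⊥-elim)
open import Data.Fin using (toℕ; zero; suc)
import Data.Fin.Properties as Fin
open import Data.Integer as ℤ using (+_)
import Data.Integer.Properties as ℤ
open import Data.Nat as ℕ
  using (zero; suc; _+_; _*_; _∸_; _^_; _<_; _≤_; s≤s; z≤n; NonZero; NonTrivial; _≟_; _<?_)
import Data.Nat.Properties as ℕ
open import Data.Nat.DivMod using (_%_; _div_; _mod_; _divMod_; result; m≡m%n+[m/n]*n)
open import Data.Nat.Divisibility
  using (_∤_; divides; quotient-<; quotient-∣; ∣-refl; ∣-trans; _∣0; _∣?_; ∣⇒≤;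
         ∣m∣n⇒∣m+n; ∣m+n∣m⇒∣n; ∣m⇒∣m*n; ∣n⇒∣m*n; m∣m*n; ∣1⇒≡1)
open import Data.Nat.Induction using (<-rec)
open import Data.Nat.Primality
  using (Irreducible; composite; composite?; prime; prime?; ¬prime[1]; euclidsLemma;
         prime⇒irreducible; irreducible⇒prime; prime⇒nonZero; prime⇒nonTrivial)
open import Data.Nat.Tactic.RingSolver using (solve-∀)
open import Data.Product using (∃-syntax; _,_)
open import Data.Rational as ℚ using (ℚ; _/_; 1ℚ; toℚᵘ) renaming (_*_ to _*ℚ_)
import Data.Rational.Properties as ℚ
open import Data.Rational.Unnormalised as ℚᵘ using (mkℚᵘ; *≡*)
import Data.Rational.Unnormalised.Properties as ℚᵘ
open import Data.Sum using (_⊎_; inj₁; inj₂; [_,_]′)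
open import Function using (id; _∘_; flip)
open import Function.Bundles using (Equivalence; mk⇔)
import Function.Properties.Equivalence as ⇔
open import Relation.Binary.PropositionalEquality
  using (_≡_; refl; sym; trans; cong; cong₂; subst; module ≡-Reasoning)
open import Relation.Nullary using (yes; no)
open import Relation.Nullary.Decidable using (True; False; toWitness; toWitnessFalse; from-yes; from-no)

open import Algebra.Properties.CommutativeSemigroup
  (CommutativeMonoid.commutativeSemigroup ℚ.*-1-commutativeMonoid)
  using (interchange; xy∙z≈y∙xz)

private variable
  m n p q y : ℕ
  x : ℚ

prime[3] : Prime 3
prime[3] = from-yes (prime? 3)

prime∤-* : Prime p → p ∤ m → p ∤ n → p ∤ m * n
prime∤-* {m = m} {n} p-prime p∤m p∤n p∣mn = [ p∤m , p∤n ]′ (euclidsLemma m n p-prime p∣mn)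

prime∤-^ : Prime p → p ∤ m → ∀ e → p ∤ m ^ e
prime∤-^ p-prime _ zero p∣1 = ¬prime[1] (subst Prime (∣1⇒≡1 p∣1) p-prime)
prime∤-^ p-prime p∤m (suc e) = prime∤-* p-prime p∤m (prime∤-^ p-prime p∤m e)

m%n≡k%n⇒n∣k∸m : ∀ m k {n} .{{_ : NonZero n}} → m % n ≡ k % n → n ∣ k ∸ m
m%n≡k%n⇒n∣k∸m m k {n} m%n≡k%n = divides (k div n ∸ m div n) (begin
  k ∸ m                                           ≡⟨ cong₂ _∸_ (m≡m%n+[m/n]*n k n) (m≡m%n+[m/n]*n m n) ⟩
  (k % n + k div n * n) ∸ (m % n + m div n * n)   ≡⟨ cong (λ r → (k % n + k div n * n) ∸ (r + m div n * n)) m%n≡k%n ⟩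
  (k % n + k div n * n) ∸ (k % n + m div n * n)   ≡⟨ ℕ.[m+n]∸[m+o]≡n∸o (k % n) _ _ ⟩
  k div n * n ∸ m div n * n                       ≡⟨ ℕ.*-distribʳ-∸ n (k div n) (m div n) ⟨
  (k div n ∸ m div n) * n                         ∎)
  where open ≡-Reasoning

powers-collide : ∀ y n .{{_ : NonZero n}} → ∃[ i ] ∃[ k ] y ^ i % n ≡ y ^ (i + suc k) % n
powers-collide y n
  with i , j , i<j , yⁱ≡yʲ ← Fin.pigeonhole (ℕ.n<1+n n) (λ i → y ^ toℕ i mod n)
  = toℕ i , k , (begin
    y ^ toℕ i % n            ≡⟨ Fin.toℕ-fromℕ< _ ⟨
    toℕ (y ^ toℕ i mod n)    ≡⟨ cong toℕ yⁱ≡yʲ ⟩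
    toℕ (y ^ toℕ j mod n)    ≡⟨ Fin.toℕ-fromℕ< _ ⟩
    y ^ toℕ j % n            ≡⟨ cong (λ e → y ^ e % n) j≡i+1+k ⟩
    y ^ (toℕ i + suc k) % n  ∎)
  where
  open ≡-Reasoning
  k : ℕ
  k = toℕ j ∸ suc (toℕ i)
  j≡i+1+k : toℕ j ≡ toℕ i + suc k
  j≡i+1+k = trans (sym (ℕ.m+[n∸m]≡n i<j)) (sym (ℕ.+-suc (toℕ i) k))

order-exists : Prime p → p ∤ y → ∃[ k ] p ∣ y ^ suc k ∸ 1
order-exists {p} {y} p-prime p∤y
  with i , k , yⁱ≡yⁱ⁺ᵏ⁺¹ ← powers-collide y p {{prime⇒nonZero p-prime}}
  = k , [ ⊥-elim ∘ prime∤-^ p-prime p∤y i , id ]′ (euclidsLemma _ _ p-prime p∣yⁱ[yᵏ⁺¹∸1])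
  where
  open ≡-Reasoning
  p∣yⁱ[yᵏ⁺¹∸1] : p ∣ y ^ i * (y ^ suc k ∸ 1)
  p∣yⁱ[yᵏ⁺¹∸1] = subst (p ∣_)
    (begin
      y ^ (i + suc k) ∸ y ^ i          ≡⟨ cong₂ _∸_ (ℕ.^-distribˡ-+-* y i (suc k)) (sym (ℕ.*-identityʳ (y ^ i))) ⟩
      y ^ i * y ^ suc k ∸ y ^ i * 1    ≡⟨ ℕ.*-distribˡ-∸ (y ^ i) _ 1 ⟨
      y ^ i * (y ^ suc k ∸ 1)          ∎)
    (m%n≡k%n⇒n∣k∸m _ _ {{prime⇒nonZero p-prime}} yⁱ≡yⁱ⁺ᵏ⁺¹)

Odd : ℕ → Set
Odd m = ∃[ k ] m ≡ suc (2 * k)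

Odd⇒1≤ : Odd m → 1 ≤ m
Odd⇒1≤ (_ , refl) = s≤s z≤n

Odd-* : Odd m → Odd n → Odd (m * n)
Odd-* (j , refl) (k , refl) = j + k + 2 * j * k , expand j k
  where
  expand : ∀ j k → suc (2 * j) * suc (2 * k) ≡ suc (2 * (j + k + 2 * j * k))
  expand = solve-∀

Odd-^ : Odd m → ∀ e → Odd (m ^ e)
Odd-^ _ zero = 0 , refl
Odd-^ odd (suc e) = Odd-* odd (Odd-^ odd e)

frac : ℕ → ℕ → ℚ
frac a b = + a / suc b

cross-mul⇒frac-≡ : ∀ a b c d → a * suc d ≡ c * suc b → frac a b ≡ frac c d
cross-mul⇒frac-≡ a b c d eq = ℚ.fromℚᵘ-cong {mkℚᵘ (+ a) b} {mkℚᵘ (+ c) d}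
  (*≡* (trans (sym (ℤ.pos-* a (suc d))) (trans (cong +_ eq) (ℤ.pos-* c (suc b)))))

frac-≡⇒cross-mul : ∀ a b c d → frac a b ≡ frac c d → a * suc d ≡ c * suc b
frac-≡⇒cross-mul a b c d eq with ℚ./-injective-≃ (mkℚᵘ (+ a) b) (mkℚᵘ (+ c) d) eq
... | *≡* e = ℤ.+-injective (trans (ℤ.pos-* a (suc d)) (trans e (sym (ℤ.pos-* c (suc b)))))

frac-* : ∀ a b c d → frac a b *ℚ frac c d ≡ frac (a * c) (d + b * suc d)
frac-* a b c d = ℚ.toℚᵘ-injective (begin
  toℚᵘ (frac a b *ℚ frac c d)            ≈⟨ ℚ.toℚᵘ-homo-* (frac a b) (frac c d) ⟩
  toℚᵘ (frac a b) ℚᵘ.* toℚᵘ (frac c d)   ≈⟨ ℚᵘ.*-cong (toℚᵘ-frac a b) (toℚᵘ-frac c d) ⟩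
  mkℚᵘ (+ a ℤ.* + c) (d + b * suc d)     ≡⟨ cong (λ z → mkℚᵘ z (d + b * suc d)) (ℤ.pos-* a c) ⟨
  mkℚᵘ (+ (a * c)) (d + b * suc d)       ≈⟨ toℚᵘ-frac (a * c) (d + b * suc d) ⟨
  toℚᵘ (frac (a * c) (d + b * suc d))    ∎)
  where
  open ℚᵘ.≃-Reasoning
  toℚᵘ-frac : ∀ a b → toℚᵘ (frac a b) ℚᵘ.≃ mkℚᵘ (+ a) b
  toℚᵘ-frac a b = ℚ.toℚᵘ-fromℚᵘ (mkℚᵘ (+ a) b)

frac-*-≡ : ∀ a b c d e f → a * c * suc f ≡ e * (suc b * suc d) → frac a b *ℚ frac c d ≡ frac e f
frac-*-≡ a b c d e f eq = trans (frac-* a b c d) (cross-mul⇒frac-≡ (a * c) (d + b * suc d) e f eq)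

3∤3k+2 : ∀ k → 3 ∤ 3 * k + 2
3∤3k+2 k 3∣3k+2 = from-no (3 ∣? 2) (∣m+n∣m⇒∣n 3∣3k+2 (m∣m*n k))

InW⇒numerator-3∤ : InW x → ∃[ a ] ∃[ b ] 3 ∤ a × x ≡ frac a b
InW⇒numerator-3∤ (gen k) = 3 * k + 2 , 2 * k , 3∤3k+2 k , refl
InW⇒numerator-3∤ half = 1 , 1 , from-no (3 ∣? 1) , refl
InW⇒numerator-3∤ (mul v w) with InW⇒numerator-3∤ v | InW⇒numerator-3∤ w
... | a , b , 3∤a , refl | c , d , 3∤c , refl =
  a * c , d + b * suc d , prime∤-* prime[3] 3∤a 3∤c , frac-* a b c d

InWZ⇒3∤ : InWZ n → 3 ∤ n
InWZ⇒3∤ {n} w 3∣n with InW⇒numerator-3∤ w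
... | a , b , 3∤a , n≡a/b = 3∤a (subst (3 ∣_)
  (trans (frac-≡⇒cross-mul n 0 a b n≡a/b) (ℕ.*-identityʳ a)) (∣m⇒∣m*n (suc b) 3∣n))

-- InWZ n unfolds to a normalised rational, from which Agda cannot recover n;
-- the record keeps n visible to unification.
record 𝒲ℤ (n : ℕ) : Set where
  constructor ⟨_⟩
  field inW : InWZ n

𝒲ℤ-* : 𝒲ℤ m → 𝒲ℤ n → 𝒲ℤ (m * n)
𝒲ℤ-* {m} {n} ⟨ v ⟩ ⟨ w ⟩ = ⟨ subst InW (frac-* m 0 n 0) (mul v w) ⟩

𝒲ℤ-1 : 𝒲ℤ 1
𝒲ℤ-1 = ⟨ mul (gen 0) half ⟩

𝒲ℤ-2 : 𝒲ℤ 2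
𝒲ℤ-2 = ⟨ gen 0 ⟩

𝒲ℤ-5 : 𝒲ℤ 5
𝒲ℤ-5 = ⟨ mul (mul (mul (mul (mul (mul (mul (mul
  (gen 71) (gen 21)) (gen 3)) (gen 60)) (gen 3)) (gen 3)) (gen 32)) half) half ⟩

𝒲ℤ-^ : 𝒲ℤ m → ∀ e → 𝒲ℤ (m ^ e)
𝒲ℤ-^ _ zero = 𝒲ℤ-1
𝒲ℤ-^ w (suc e) = 𝒲ℤ-* w (𝒲ℤ-^ w e)

𝒲ℤ-3k+2 : ∀ k → 𝒲ℤ (suc (2 * k)) → 𝒲ℤ (3 * k + 2)
𝒲ℤ-3k+2 k ⟨ w ⟩ = ⟨ subst InW g[k]*[2k+1]≡3k+2 (mul (gen k) w) ⟩
  where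
  cross : ∀ k → (3 * k + 2) * suc (2 * k) * 1 ≡ (3 * k + 2) * (suc (2 * k) * 1)
  cross = solve-∀
  g[k]*[2k+1]≡3k+2 : g k *ℚ ⟦ suc (2 * k) ⟧ ≡ ⟦ 3 * k + 2 ⟧
  g[k]*[2k+1]≡3k+2 = frac-*-≡ (3 * k + 2) (2 * k) (suc (2 * k)) 0 (3 * k + 2) 0 (cross k)

𝒲ℤ-3m+1 : Odd m → 𝒲ℤ m → 𝒲ℤ (3 * m + 1)
𝒲ℤ-3m+1 (k , refl) w = subst 𝒲ℤ (2[3k+2]≡3[2k+1]+1 k) (𝒲ℤ-* 𝒲ℤ-2 (𝒲ℤ-3k+2 k w))
  where
  2[3k+2]≡3[2k+1]+1 : ∀ k → 2 * (3 * k + 2) ≡ 3 * suc (2 * k) + 1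
  2[3k+2]≡3[2k+1]+1 = solve-∀

InWinv⇒inverse∈InW : InWinv x → ∃[ y ] InW y × x *ℚ y ≡ 1ℚ
InWinv⇒inverse∈InW (gen n) =
  g n , gen n , frac-*-≡ (suc (2 * n)) (3 * n + 1) (3 * n + 2) (2 * n) 1 0 (cross n)
  where
  cross : ∀ n → suc (2 * n) * (3 * n + 2) * 1 ≡ 1 * (suc (3 * n + 1) * suc (2 * n))
  cross = solve-∀
InWinv⇒inverse∈InW two = + 1 / 2 , half , refl
InWinv⇒inverse∈InW (mul {x₁} {x₂} v w)
  with y₁ , w₁ , x₁y₁≡1 ← InWinv⇒inverse∈InW v
     | y₂ , w₂ , x₂y₂≡1 ← InWinv⇒inverse∈InW w
  = y₁ *ℚ y₂ , mul w₁ w₂ , trans (interchange x₁ x₂ y₁ y₂) (cong₂ _*ℚ_ x₁y₁≡1 x₂y₂≡1)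

𝒲ℤ-∣ : Weak3x+1 → m ∣ n → 𝒲ℤ n → 𝒲ℤ m
𝒲ℤ-∣ W (divides zero refl) ⟨ w ⟩ = ⊥-elim (InWZ⇒3∤ w (3 ∣0))
𝒲ℤ-∣ {m} W (divides (suc q) refl) ⟨ w ⟩
  with y , w-y , [1+q]y≡1 ← InWinv⇒inverse∈InW (W q)
  = ⟨ subst InW [1+q]m*y≡m (mul w w-y) ⟩
  where
  open ≡-Reasoning
  [1+q]m*y≡m : ⟦ suc q * m ⟧ *ℚ y ≡ ⟦ m ⟧
  [1+q]m*y≡m = begin
    ⟦ suc q * m ⟧ *ℚ y            ≡⟨ cong (_*ℚ y) (frac-* (suc q) 0 m 0) ⟨
    ⟦ suc q ⟧ *ℚ ⟦ m ⟧ *ℚ y       ≡⟨ xy∙z≈y∙xz ⟦ suc q ⟧ ⟦ m ⟧ y ⟩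
    ⟦ m ⟧ *ℚ (⟦ suc q ⟧ *ℚ y)     ≡⟨ cong (⟦ m ⟧ *ℚ_) [1+q]y≡1 ⟩
    ⟦ m ⟧ *ℚ 1ℚ                   ≡⟨ ℚ.*-identityʳ ⟦ m ⟧ ⟩
    ⟦ m ⟧                         ∎

𝒲ℤ-∣3m+1 : ∀ {d} → Weak3x+1 → Odd m → 𝒲ℤ m → d ∣ 3 * m + 1 → 𝒲ℤ d
𝒲ℤ-∣3m+1 W odd w d∣3m+1 = 𝒲ℤ-∣ W d∣3m+1 (𝒲ℤ-3m+1 odd w)

𝒲ℤ-7 : Weak3x+1 → 𝒲ℤ 7
𝒲ℤ-7 W = 𝒲ℤ-∣3m+1 W (312 , refl) (𝒲ℤ-^ 𝒲ℤ-5 4) (divides 268 refl)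

𝒲ℤ-11 : Weak3x+1 → 𝒲ℤ 11
𝒲ℤ-11 W = 𝒲ℤ-∣3m+1 W (3 , refl) (𝒲ℤ-7 W) (divides 2 refl)

𝒲ℤ-13 : Weak3x+1 → 𝒲ℤ 13
𝒲ℤ-13 W = 𝒲ℤ-∣3m+1 W (60 , refl) (𝒲ℤ-* (𝒲ℤ-11 W) (𝒲ℤ-11 W)) (divides 28 refl)

𝒲ℤ-17 : Weak3x+1 → 𝒲ℤ 17
𝒲ℤ-17 W = 𝒲ℤ-∣3m+1 W (5 , refl) (𝒲ℤ-11 W) (divides 2 refl)

𝒲ℤ-19 : Weak3x+1 → 𝒲ℤ 19
𝒲ℤ-19 W = 𝒲ℤ-∣3m+1 W (12 , refl) (𝒲ℤ-* 𝒲ℤ-5 𝒲ℤ-5) (divides 4 refl)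

module Admissibility (W : Weak3x+1) (p-prime : Prime p) where

  Admissible : ℕ → Set
  Admissible m = 𝒲ℤ m × Odd m × p ∤ m

  admissible : (∀ {m} → m < p → 3 ∤ m → 𝒲ℤ m) → m < p → Odd m → 3 ∤ m → Admissible m
  admissible IH m<p odd@(_ , refl) 3∤m = IH m<p 3∤m , odd , λ p∣m → ℕ.<⇒≱ m<p (∣⇒≤ p∣m)

  admissible-* : Admissible m → Admissible n → Admissible (m * n)
  admissible-* (v , odd-m , p∤m) (w , odd-n , p∤n) =
    𝒲ℤ-* v w , Odd-* odd-m odd-n , prime∤-* p-prime p∤m p∤n

  𝒲ℤ-∣3N+Y : ∀ {N Y} → Admissible N → Admissible Y → p ∣ 3 * N + Y → 𝒲ℤ p
  𝒲ℤ-∣3N+Y {N} {Y} (wN , odd-N , _) (wY , odd-Y , p∤Y) p∣3N+Y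
    with k , p∣Yᵏ⁺¹∸1 ← order-exists p-prime p∤Y
    = 𝒲ℤ-∣3m+1 W (Odd-* odd-N (Odd-^ odd-Y k)) (𝒲ℤ-* wN (𝒲ℤ-^ wY k)) p∣3d+1
    where
    open ≡-Reasoning
    d : ℕ
    d = N * Y ^ k
    distrib : ∀ N Y Z → (3 * N + Y) * Z ≡ 3 * (N * Z) + Y * Z
    distrib = solve-∀
    swap : ∀ u v → u + (v + 1) ≡ v + (u + 1)
    swap = solve-∀
    split : (3 * N + Y) * Y ^ k ≡ (Y ^ suc k ∸ 1) + (3 * d + 1)
    split = begin
      (3 * N + Y) * Y ^ k            ≡⟨ distrib N Y (Y ^ k) ⟩
      3 * d + Y ^ suc k              ≡⟨ cong (_+_ (3 * d)) (ℕ.m∸n+n≡m (Odd⇒1≤ (Odd-^ odd-Y (suc k)))) ⟨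
      3 * d + (Y ^ suc k ∸ 1 + 1)    ≡⟨ swap (3 * d) (Y ^ suc k ∸ 1) ⟩
      (Y ^ suc k ∸ 1) + (3 * d + 1)  ∎
    p∣3d+1 : p ∣ 3 * d + 1
    p∣3d+1 = ∣m+n∣m⇒∣n (subst (p ∣_) split (∣m⇒∣m*n (Y ^ k) p∣3N+Y)) p∣Yᵏ⁺¹∸1

module Shifted (W : Weak3x+1) {P s : ℕ} (p-prime : Prime (P + s * 6))
               (IH : ∀ {m} → m < P + s * 6 → 3 ∤ m → 𝒲ℤ m) where

  open Admissibility W p-prime public

  unshifted : ∀ r → {True (r <? P)} → {False (3 ∣? r)} → Odd r → Admissible r
  unshifted r {r<P} {3∤r} odd =
    admissible IH (ℕ.≤-trans (toWitness r<P) (ℕ.m≤m+n P (s * 6))) odd (toWitnessFalse 3∤r)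

  shifted : ∀ r → {True (r <? P)} → {False (3 ∣? r)} → Odd r → Admissible (r + s * 6)
  shifted r {r<P} {3∤r} (k , refl) =
    admissible IH (ℕ.+-monoˡ-< (s * 6) (toWitness r<P)) (k + s * 3 , odd k s) 3∤r+6s
    where
    odd : ∀ k s → suc (2 * k) + s * 6 ≡ suc (2 * (k + s * 3))
    odd = solve-∀
    3∤r+6s : 3 ∤ r + s * 6
    3∤r+6s 3∣r+6s = toWitnessFalse 3∤r
      (∣m+n∣m⇒∣n (subst (3 ∣_) (ℕ.+-comm r (s * 6)) 3∣r+6s) (∣n⇒∣m*n s (divides 2 refl)))

-- With u = p - 20: N = u ≡ -20 and Y = 5 (u + 18) (u + 14) ≡ 5 · (-2) · (-6) = 60 ≡ -3N (mod p).
𝒲ℤ-25+6s : Weak3x+1 → ∀ s → Prime (25 + s * 6) →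
           (∀ {m} → m < 25 + s * 6 → 3 ∤ m → 𝒲ℤ m) → 𝒲ℤ (25 + s * 6)
𝒲ℤ-25+6s W s p-prime IH = 𝒲ℤ-∣3N+Y N Y (divides (63 + 5 * u) (3N+Y≡cp u))
  where
  open Shifted W {25} {s} p-prime IH
  u : ℕ
  u = 5 + s * 6
  N : Admissible u
  N = shifted 5 (2 , refl)
  Y : Admissible (5 * (18 + u) * (14 + u))
  Y = admissible-* (admissible-* (unshifted 5 (2 , refl)) (shifted 23 (11 , refl))) (shifted 19 (9 , refl))
  3N+Y≡cp : ∀ u → 3 * u + 5 * (18 + u) * (14 + u) ≡ (63 + 5 * u) * (20 + u)
  3N+Y≡cp = solve-∀

-- With u = p - 10: N = u³ ≡ -1000 and Y = 5³ (u + 4) (u + 6) ≡ 125 · (-6) · (-4) = 3000 ≡ -3N (mod p).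
𝒲ℤ-23+6s : Weak3x+1 → ∀ s → Prime (23 + s * 6) →
           (∀ {m} → m < 23 + s * 6 → 3 ∤ m → 𝒲ℤ m) → 𝒲ℤ (23 + s * 6)
𝒲ℤ-23+6s W s p-prime IH = 𝒲ℤ-∣3N+Y N Y (divides (300 + 95 * u + 3 * (u * u)) (3N+Y≡cp u))
  where
  open Shifted W {23} {s} p-prime IH
  u : ℕ
  u = 13 + s * 6
  N : Admissible (u * u * u)
  N = admissible-* (admissible-* (shifted 13 (6 , refl)) (shifted 13 (6 , refl))) (shifted 13 (6 , refl))
  five : Admissible 5
  five = unshifted 5 (2 , refl)
  Y : Admissible (5 * 5 * 5 * (4 + u) * (6 + u))
  Y = admissible-* (admissible-* (admissible-* (admissible-* five five) five) (shifted 17 (8 , refl)))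
                   (shifted 19 (9 , refl))
  3N+Y≡cp : ∀ u → 3 * (u * u * u) + 5 * 5 * 5 * (4 + u) * (6 + u) ≡ (300 + 95 * u + 3 * (u * u)) * (10 + u)
  3N+Y≡cp = solve-∀

prime-∣⇒≡ : ∀ {d} → Prime p → .{{NonTrivial d}} → d ∣ p → d ≡ p
prime-∣⇒≡ p-prime d∣p = [ ⊥-elim ∘ ℕ.nonTrivial⇒≢1 , id ]′ (prime⇒irreducible p-prime d∣p)

prime-mod-6 : Prime p → p ≢ 3 → p ≡ 2 ⊎ ∃[ q ] p ≡ 1 + q * 6 ⊎ ∃[ q ] p ≡ 5 + q * 6
prime-mod-6 {p} p-prime p≢3 with p divMod 6
... | result q zero refl =
  ⊥-elim (p≢3 (sym (prime-∣⇒≡ p-prime (∣n⇒∣m*n q (divides 2 refl)))))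
... | result q (suc zero) refl = inj₂ (inj₁ (q , refl))
... | result q (suc (suc zero)) refl =
  inj₁ (sym (prime-∣⇒≡ p-prime (∣m∣n⇒∣m+n ∣-refl (∣n⇒∣m*n q (divides 3 refl)))))
... | result q (suc (suc (suc zero))) refl =
  ⊥-elim (p≢3 (sym (prime-∣⇒≡ p-prime (∣m∣n⇒∣m+n ∣-refl (∣n⇒∣m*n q (divides 2 refl))))))
... | result q (suc (suc (suc (suc zero)))) refl =
  inj₁ (sym (prime-∣⇒≡ p-prime (∣m∣n⇒∣m+n (divides 2 refl) (∣n⇒∣m*n q (divides 3 refl)))))
... | result q (suc (suc (suc (suc (suc zero))))) refl = inj₂ (inj₂ (q , refl))

𝒲ℤ-prime : Weak3x+1 → Prime p → p ≢ 3 → (∀ {m} → m < p → 3 ∤ m → 𝒲ℤ m) → 𝒲ℤ p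
𝒲ℤ-prime W p-prime p≢3 IH with prime-mod-6 p-prime p≢3
... | inj₁ refl = 𝒲ℤ-2
... | inj₂ (inj₁ (0 , refl)) = ⊥-elim (¬prime[1] p-prime)
... | inj₂ (inj₁ (1 , refl)) = 𝒲ℤ-7 W
... | inj₂ (inj₁ (2 , refl)) = 𝒲ℤ-13 W
... | inj₂ (inj₁ (3 , refl)) = 𝒲ℤ-19 W
... | inj₂ (inj₁ (suc (suc (suc (suc s))) , refl)) = 𝒲ℤ-25+6s W s p-prime IH
... | inj₂ (inj₂ (0 , refl)) = 𝒲ℤ-5
... | inj₂ (inj₂ (1 , refl)) = 𝒲ℤ-11 W
... | inj₂ (inj₂ (2 , refl)) = 𝒲ℤ-17 W
... | inj₂ (inj₂ (suc (suc (suc s)) , refl)) = 𝒲ℤ-23+6s W s p-prime IH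

𝒲ℤ-complete : Weak3x+1 → ∀ n → 3 ∤ n → 𝒲ℤ n
𝒲ℤ-complete W = <-rec (λ n → 3 ∤ n → 𝒲ℤ n) step
  where
  step : ∀ n → (∀ {m} → m < n → 3 ∤ m → 𝒲ℤ m) → 3 ∤ n → 𝒲ℤ n
  step 0 _ 3∤0 = ⊥-elim (3∤0 (3 ∣0))
  step 1 _ _ = 𝒲ℤ-1
  step n@(suc (suc _)) IH 3∤n with composite? n
  ... | yes (composite {d} d<n d∣n@(divides q n≡qd)) =
    subst 𝒲ℤ (sym n≡qd) (𝒲ℤ-* (IH (quotient-< d∣n) (3∤n ∘ flip ∣-trans (quotient-∣ d∣n)))
                                (IH d<n (3∤n ∘ flip ∣-trans d∣n)))
  ... | no ¬composite = 𝒲ℤ-prime W (prime ¬composite) (λ n≡3 → 3∤n (subst (3 ∣_) (sym n≡3) ∣-refl)) IH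

IrreducibleIn : (ℕ → Set) → ℕ → Set
IrreducibleIn S n = S n × n ≢ 1 × ¬ (∃[ a ] ∃[ b ] (S a × S b × a ≢ 1 × b ≢ 1 × n ≡ a * b))

IrreducibleIn-map : ∀ {S T} → (∀ {m} → S m → T m) → (∀ {m} → T m → S m) →
                    IrreducibleIn S n → IrreducibleIn T n
IrreducibleIn-map to from (s , n≢1 , irreducible) =
  to s , n≢1 , λ (a , b , ta , tb , rest) → irreducible (a , b , from ta , from tb , rest)

IrreducibleIn-cong : ∀ {S T} → (∀ m → S m ⇔ T m) → ∀ n → IrreducibleIn S n ⇔ IrreducibleIn T n
IrreducibleIn-cong {S} {T} S⇔T n = mk⇔ (IrreducibleIn-map to from) (IrreducibleIn-map from to)
  where
  to : ∀ {m} → S m → T m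
  to {m} = Equivalence.to (S⇔T m)
  from : ∀ {m} → T m → S m
  from {m} = Equivalence.from (S⇔T m)

IrreducibleIn-∤⇔prime : Prime q → ∀ n → IrreducibleIn (q ∤_) n ⇔ (Prime n × n ≢ q)
IrreducibleIn-∤⇔prime {q} q-prime n = mk⇔ (to n) from
  where
  to : ∀ n → IrreducibleIn (q ∤_) n → Prime n × n ≢ q
  to 0 (q∤0 , _) = ⊥-elim (q∤0 (q ∣0))
  to 1 (_ , 1≢1 , _) = ⊥-elim (1≢1 refl)
  to n@(suc (suc _)) (q∤n , _ , unfactorable) =
    irreducible⇒prime irreducible , λ n≡q → q∤n (subst (q ∣_) (sym n≡q) ∣-refl)
    where
    irreducible : Irreducible n
    irreducible {d} d∣n@(divides e n≡ed) with d ≟ 1 | e ≟ 1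
    ... | yes d≡1 | _ = inj₁ d≡1
    ... | no _ | yes refl = inj₂ (sym (trans n≡ed (ℕ.*-identityˡ d)))
    ... | no d≢1 | no e≢1 = ⊥-elim (unfactorable (e , d ,
      q∤n ∘ flip ∣-trans (quotient-∣ d∣n) , q∤n ∘ flip ∣-trans d∣n , e≢1 , d≢1 , n≡ed))
  from : Prime n × n ≢ q → IrreducibleIn (q ∤_) n
  from (n-prime , n≢q) = q∤n , ℕ.nonTrivial⇒≢1 {{prime⇒nonTrivial n-prime}} , unfactorable
    where
    q∤n : q ∤ n
    q∤n q∣n = [ ¬prime[1] ∘ flip (subst Prime) q-prime , n≢q ∘ sym ]′ (prime⇒irreducible n-prime q∣n)
    unfactorable : ¬ (∃[ a ] ∃[ b ] (q ∤ a × q ∤ b × a ≢ 1 × b ≢ 1 × n ≡ a * b))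
    unfactorable (a , b , _ , _ , a≢1 , b≢1 , n≡ab)
      with prime⇒irreducible n-prime (divides b (trans n≡ab (ℕ.*-comm a b)))
    ... | inj₁ a≡1 = a≢1 a≡1
    ... | inj₂ refl = b≢1 (ℕ.*-cancelˡ-≡ b 1 a {{prime⇒nonZero n-prime}}
                            (trans (sym n≡ab) (sym (ℕ.*-identityʳ a))))

theorem3p3 : Weak3x+1 →
    ((n : ℕ) → InWZ n ⇔ (¬ (3 ∣ n)))
    × ((n : ℕ) → Wild n ⇔ (Prime n × n ≢ 3))
theorem3p3 W = InWZ⇔3∤ , λ n → ⇔.trans (IrreducibleIn-cong InWZ⇔3∤ n) (IrreducibleIn-∤⇔prime prime[3] n)
  where
  InWZ⇔3∤ : ∀ n → InWZ n ⇔ 3 ∤ n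
  InWZ⇔3∤ n = mk⇔ InWZ⇒3∤ (𝒲ℤ.inW ∘ 𝒲ℤ-complete W n)
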